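{- There is an infinite family $(G_k)_{k\ge1}$ of mixed interval graphs such that, for every $k\ge1$, $|V(G_k)|=2k^2$, $\lambda(G_k)=k-1$, $\omega(G_k)=2k$, and $\chi(G_k)=(k+1)\cdot k=(\lambda(G_k)+2)\cdot\omega(G_k)/2$.
   Context: A mixed interval graph is an interval graph (intersection graph of a finite family of intervals on the real line) in which every adjacent pair is joined either by an undirected edge or by an arc directed arbitrarily. A proper coloring of a mixed graph $G$ is a function $f\colon V(G)\to\mathbb{N}$ such that $f(u)\neq f(v)$ for every edge $\{u,v\}$ and $f(u)<f(v)$ for every arc $(u,v)$; $\chi(G)$ is the minimum number of colors of a proper coloring. $\omega(G)$ is the size of a largest clique in the underlying undirected graph of $G$ (which has an edge for every edge or arc of $G$). A directed path of length $t$ is a sequence of vertices $v_1,\dots,v_{t+1}$ with an arc $(v_i,v_{i+1})$ for each $i\in[t]$, and $\lambda(G)$ is the length of a longest directed path in $G$. -}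

module Defs where

open import Data.Nat using (ℕ; zero; suc; _≤_; _<_)
open import Data.Fin using (Fin; toℕ; inject₁) renaming (suc to fsuc)
open import Data.Product using (Σ; _×_; ∃)
open import Relation.Binary.PropositionalEquality using (_≡_; _≢_)
open import Relation.Nullary using (¬_)
open import Function.Definitions using (Injective)

data Adj : Set where
  none  : Adj
  edge  : Adj
  out   : Adj   -- arc (u , v)
  inc   : Adj   -- arc (v , u)

flipAdj : Adj → Adj
flipAdj none = none
flipAdj edge = edge
flipAdj out  = inc
flipAdj inc  = out

record MixedGraph (n : ℕ) : Set where
  field
    adj       : Fin n → Fin n → Adj
    adj-flip  : ∀ u v → adj v u ≡ flipAdj (adj u v)
    adj-loop  : ∀ u → adj u u ≡ none

module _ {n : ℕ} (G : MixedGraph n) where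
  open MixedGraph G

  Edge : Fin n → Fin n → Set
  Edge u v = adj u v ≡ edge

  Arc : Fin n → Fin n → Set
  Arc u v = adj u v ≡ out

  Adjacent : Fin n → Fin n → Set
  Adjacent u v = adj u v ≢ none

  -- G is an interval graph: there are closed intervals [l v , r v] (endpoints in ℕ,
  -- which is no loss of generality for finite families) such that distinct
  -- vertices are adjacent iff their intervals intersect.
  IsIntervalGraph : Set
  IsIntervalGraph =
    Σ (Fin n → ℕ) λ l → Σ (Fin n → ℕ) λ r →
      (∀ v → l v ≤ r v) ×
      (∀ u v → u ≢ v → (Adjacent u v → (l u ≤ r v × l v ≤ r u))
                     × ((l u ≤ r v × l v ≤ r u) → Adjacent u v))

  IsProperColoring : (c : ℕ) → (Fin n → Fin c) → Set
  IsProperColoring c f =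
    (∀ u v → Edge u v → f u ≢ f v) × (∀ u v → Arc u v → toℕ (f u) < toℕ (f v))

  ChromaticNumber : ℕ → Set
  ChromaticNumber c =
    Σ (Fin n → Fin c) (IsProperColoring c) ×
    (∀ m (f : Fin n → Fin m) → IsProperColoring m f → c ≤ m)

  IsClique : (m : ℕ) → (Fin m → Fin n) → Set
  IsClique m s = Injective _≡_ _≡_ s × (∀ i j → i ≢ j → Adjacent (s i) (s j))

  CliqueNumber : ℕ → Set
  CliqueNumber m =
    Σ (Fin m → Fin n) (IsClique m) ×
    (∀ m' (s : Fin m' → Fin n) → IsClique m' s → m' ≤ m)

  IsDirectedPath : (t : ℕ) → (Fin (suc t) → Fin n) → Set
  IsDirectedPath t p =
    Injective _≡_ _≡_ p × (∀ (i : Fin t) → Arc (p (inject₁ i)) (p (fsuc i)))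

  LongestDirectedPath : ℕ → Set
  LongestDirectedPath t =
    Σ (Fin (suc t) → Fin n) (IsDirectedPath t) ×
    (∀ t' (p : Fin (suc t') → Fin n) → IsDirectedPath t' p → t' ≤ t)

-- G_k is a row of 2k blocks of k vertices, block a occupying the interval [a, a+1]; vertices in
-- the same block are joined by edges, consecutive blocks completely by arcs pointing towards the
-- middle, except that the two middle blocks are joined by edges.  A directed path stays inside one
-- half, so it has length at most k − 1.  A clique lies in two consecutive blocks, and the two
-- middle blocks form one of size 2k.  In a proper colouring every block uses k distinct colours,
-- each above all colours of the previous block on its side, so both middle blocks only use colours
-- at least (k − 1)k; being a clique of 2k edges they need 2k of them, hence (k + 1)k colours.
-- Colouring the m-th vertex of block a by h(a)k + m attains this, where the height h runs
-- through 0, …, k − 1 on the left half and k, …, 1 on the right half.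
module Submission where

open import Defs
open import Data.Nat using (ℕ; zero; suc; _≤_; _<_; _+_; _*_; _∸_; z≤n; s≤s; z<s; _<?_)
open import Data.Nat.Properties hiding (_≟_)
open import Data.Fin using (Fin; toℕ; fromℕ; fromℕ<; inject₁; combine; quotient; remainder; opposite)
  renaming (zero to fzero; suc to fsuc)
open import Data.Fin.Properties
  using (_≟_; toℕ<n; toℕ-injective; toℕ-fromℕ<; toℕ-inject₁; remQuot-combine; combine-remQuot;
         combine-injectiveˡ; combine-injectiveʳ; combine-monoˡ-<; injective⇒≤)
open import Data.Product using (Σ; _×_; _,_; proj₁; proj₂)
open import Data.Sum using (_⊎_; inj₁; inj₂; [_,_]′) renaming (map to map-⊎)
open import Function using (_∘_)
open import Function.Definitions using (Injective)
open import Relation.Nullary using (¬_; yes; no; contradiction)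
open import Relation.Binary.PropositionalEquality

injective-in-range⇒≤ : ∀ {m L B} {f : Fin m → ℕ} → Injective _≡_ _≡_ f →
                       (∀ i → L ≤ f i) → (∀ i → f i < B) → m ≤ B ∸ L
injective-in-range⇒≤ {L = L} {f = f} f-injective above below = injective⇒≤ shifted-injective
  where
  shifted : Fin _ → Fin _
  shifted i = fromℕ< (∸-monoˡ-< (below i) (above i))

  shifted-injective : Injective _≡_ _≡_ shifted
  shifted-injective {i} {j} eq = f-injective (∸-cancelʳ-≡ (above i) (above j) (begin
    f i ∸ L          ≡⟨ toℕ-fromℕ< _ ⟨
    toℕ (shifted i)  ≡⟨ cong toℕ eq ⟩
    toℕ (shifted j)  ≡⟨ toℕ-fromℕ< _ ⟩
    f j ∸ L          ∎))
    where open ≡-Reasoning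

increasing⇒length≤last : ∀ {t} (q : Fin (suc t) → ℕ) →
                         (∀ i → q (inject₁ i) < q (fsuc i)) → t ≤ q (fromℕ t)
increasing⇒length≤last {zero}  _ _          = z≤n
increasing⇒length≤last {suc t} q increasing =
  ≤-<-trans (increasing⇒length≤last (q ∘ inject₁) (increasing ∘ inject₁)) (increasing (fromℕ t))

flipAdj-involutive : ∀ x → flipAdj (flipAdj x) ≡ x
flipAdj-involutive none = refl
flipAdj-involutive edge = refl
flipAdj-involutive out  = refl
flipAdj-involutive inc  = refl

flipAdj-injective : ∀ {x y} → flipAdj x ≡ flipAdj y → x ≡ y
flipAdj-injective {x} {y} eq =
  trans (sym (flipAdj-involutive x)) (trans (cong flipAdj eq) (flipAdj-involutive y))

module _ {N : ℕ} (G : MixedGraph N) where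
  open MixedGraph G

  IsEdgeClique : ∀ {m} → (Fin m → Fin N) → Set
  IsEdgeClique s = ∀ i j → i ≢ j → Edge G (s i) (s j)

  edge-clique⇒clique : ∀ {m} {s : Fin m → Fin N} → IsEdgeClique s → IsClique G m s
  edge-clique⇒clique {s = s} edges = s-injective , λ i j i≢j → adjacent (edges i j i≢j)
    where
    adjacent : ∀ {u v} → Edge G u v → Adjacent G u v
    adjacent e eq = contradiction (trans (sym e) eq) λ ()

    s-injective : Injective _≡_ _≡_ s
    s-injective {i} {j} si≡sj with i ≟ j
    ... | yes i≡j = i≡j
    ... | no  i≢j = contradiction (adj-loop (s j)) (adjacent (subst (λ u → Edge G u (s j)) si≡sj (edges i j i≢j)))

  edge-clique-colour-count : ∀ {M m L B} {g : Fin N → Fin M} {s : Fin m → Fin N} →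
    IsProperColoring G M g → IsEdgeClique s →
    (∀ i → L ≤ toℕ (g (s i))) → (∀ i → toℕ (g (s i)) < B) → m ≤ B ∸ L
  edge-clique-colour-count {g = g} {s} (edge-colours , _) edges above below =
    injective-in-range⇒≤ colours-injective above below
    where
    colours-injective : Injective _≡_ _≡_ (toℕ ∘ g ∘ s)
    colours-injective {i} {j} eq with i ≟ j
    ... | yes i≡j = i≡j
    ... | no  i≢j = contradiction (toℕ-injective eq) (edge-colours _ _ (edges i j i≢j))

  directed-path-length≤ : ∀ {t} (ψ : Fin N → ℕ) → (∀ {u v} → Arc G u v → ψ u < ψ v) →
    (∀ v → ψ v ≤ t) → ∀ {t′ p} → IsDirectedPath G t′ p → t′ ≤ t
  directed-path-length≤ ψ increases bounded {p = p} (_ , arcs) =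
    ≤-trans (increasing⇒length≤last (ψ ∘ p) (increases ∘ arcs)) (bounded _)

data Link : Set where
  undirected forward backward : Link

linkAdj : Link → Adj
linkAdj undirected = edge
linkAdj forward    = out
linkAdj backward   = inc

linkAdj-injective : ∀ {ℓ ℓ′} → linkAdj ℓ ≡ linkAdj ℓ′ → ℓ ≡ ℓ′
linkAdj-injective {undirected} {undirected} _ = refl
linkAdj-injective {forward}    {forward}    _ = refl
linkAdj-injective {backward}   {backward}   _ = refl
linkAdj-injective {undirected} {forward}    ()
linkAdj-injective {undirected} {backward}   ()
linkAdj-injective {forward}    {undirected} ()
linkAdj-injective {forward}    {backward}   ()
linkAdj-injective {backward}   {undirected} ()
linkAdj-injective {backward}   {forward}    ()

linkAdj≢none : ∀ ℓ → linkAdj ℓ ≢ none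
linkAdj≢none undirected ()
linkAdj≢none forward    ()
linkAdj≢none backward   ()

-- the unit intervals [a, a+1] and [b, b+1] meet
Close : ℕ → ℕ → Set
Close a b = a ≤ suc b × b ≤ suc a

close-same : ∀ {a} → Close a a
close-same = n≤1+n _ , n≤1+n _

close-next : ∀ {a} → Close a (suc a)
close-next = m≤n⇒m≤1+n (n≤1+n _) , ≤-refl

close-prev : ∀ {a} → Close (suc a) a
close-prev = ≤-refl , m≤n⇒m≤1+n (n≤1+n _)

data Gap : ℕ → ℕ → Set where
  same : ∀ a → Gap a a
  next : ∀ a → Gap a (suc a)
  prev : ∀ a → Gap (suc a) a
  far  : ∀ {a b} → ¬ Close a b → Gap a b

gap : ∀ a b → Gap a b
gap zero          zero          = same 0
gap zero          (suc zero)    = next 0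
gap (suc zero)    zero          = prev 0
gap zero          (suc (suc b)) = far λ { (_ , s≤s ()) }
gap (suc (suc a)) zero          = far λ { (s≤s () , _) }
gap (suc a)       (suc b)       = shift (gap a b)
  where
  shift : ∀ {a b} → Gap a b → Gap (suc a) (suc b)
  shift (same a)     = same (suc a)
  shift (next a)     = next (suc a)
  shift (prev a)     = prev (suc a)
  shift (far ¬close) = far λ { (s≤s p , s≤s q) → ¬close (p , q) }

opposite-≢ : ∀ (i : Fin 2) → i ≢ opposite i
opposite-≢ fzero        ()
opposite-≢ (fsuc fzero) ()

parity : ℕ → Fin 2
parity zero    = fzero
parity (suc a) = opposite (parity a)

-- The blow-up of a path of n blocks of size c: the link between blocks a and a+1 decides whether
-- all pairs between them are edges, arcs from block a, or arcs into block a.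
module BlowUp (n c : ℕ) (link : ℕ → Link) where

  sameBlock : Fin c → Fin c → Adj
  sameBlock m m′ with m ≟ m′
  ... | yes _ = none
  ... | no  _ = edge

  sameBlock-refl : ∀ m → sameBlock m m ≡ none
  sameBlock-refl m with m ≟ m
  ... | yes _   = refl
  ... | no  m≢m = contradiction refl m≢m

  sameBlock-≢ : ∀ {m m′} → m ≢ m′ → sameBlock m m′ ≡ edge
  sameBlock-≢ {m} {m′} m≢m′ with m ≟ m′
  ... | yes m≡m′ = contradiction m≡m′ m≢m′
  ... | no  _    = refl

  sameBlock-flip : ∀ m m′ → sameBlock m′ m ≡ flipAdj (sameBlock m m′)
  sameBlock-flip m m′ with m ≟ m′
  ... | yes refl = sameBlock-refl m
  ... | no  m≢m′ = sameBlock-≢ (≢-sym m≢m′)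

  sameBlock≢out : ∀ m m′ → sameBlock m m′ ≢ out
  sameBlock≢out m m′ with m ≟ m′
  ... | yes _ = λ ()
  ... | no  _ = λ ()

  blockAdj : ∀ {a b} → Gap a b → Fin c → Fin c → Adj
  blockAdj (same _) m m′ = sameBlock m m′
  blockAdj (next a) _ _  = linkAdj (link a)
  blockAdj (prev b) _ _  = flipAdj (linkAdj (link b))
  blockAdj (far _)  _ _  = none

  Linked : Link → ℕ → ℕ → Set
  Linked ℓ a b = b ≡ suc a × link a ≡ ℓ

  blockAdj-loop : ∀ {a m} (g : Gap a a) → blockAdj g m m ≡ none
  blockAdj-loop (same _) = sameBlock-refl _
  blockAdj-loop (far _)  = refl

  blockAdj-flip : ∀ {a b m m′} (g : Gap a b) (g′ : Gap b a) →
                  blockAdj g′ m′ m ≡ flipAdj (blockAdj g m m′)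
  blockAdj-flip {m = m} {m′} (same _) (same _) = sameBlock-flip m m′
  blockAdj-flip (next _)     (prev _)     = refl
  blockAdj-flip (prev _)     (next _)     = sym (flipAdj-involutive _)
  blockAdj-flip (far _)      (far _)      = refl
  blockAdj-flip (same _)     (far ¬close) = contradiction close-same ¬close
  blockAdj-flip (next _)     (far ¬close) = contradiction close-prev ¬close
  blockAdj-flip (prev _)     (far ¬close) = contradiction close-next ¬close
  blockAdj-flip (far ¬close) (same _)     = contradiction close-same ¬close
  blockAdj-flip (far ¬close) (next _)     = contradiction close-prev ¬close
  blockAdj-flip (far ¬close) (prev _)     = contradiction close-next ¬close

  blockAdj-same : ∀ {a b m m′} (g : Gap a b) → a ≡ b → m ≢ m′ → blockAdj g m m′ ≡ edge
  blockAdj-same (same _)     _    m≢m′ = sameBlock-≢ m≢m′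
  blockAdj-same (far ¬close) refl _    = contradiction close-same ¬close

  blockAdj-next : ∀ {a b m m′} (g : Gap a b) → b ≡ suc a → blockAdj g m m′ ≡ linkAdj (link a)
  blockAdj-next (next _)     refl = refl
  blockAdj-next (far ¬close) refl = contradiction close-next ¬close

  blockAdj⇒close : ∀ {a b m m′} (g : Gap a b) → blockAdj g m m′ ≢ none → Close a b
  blockAdj⇒close (same _) _        = close-same
  blockAdj⇒close (next _) _        = close-next
  blockAdj⇒close (prev _) _        = close-prev
  blockAdj⇒close (far _)  adjacent = contradiction refl adjacent

  close⇒blockAdj : ∀ {a b m m′} (g : Gap a b) → Close a b → ¬ (a ≡ b × m ≡ m′) →
                   blockAdj g m m′ ≢ none
  close⇒blockAdj {m = m} {m′} (same _) _ distinct
    rewrite sameBlock-≢ {m} {m′} (λ m≡m′ → distinct (refl , m≡m′)) = λ ()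
  close⇒blockAdj (next a)     _     _ = linkAdj≢none (link a)
  close⇒blockAdj (prev b)     _     _ = linkAdj≢none (link b) ∘ flipAdj-injective
  close⇒blockAdj (far ¬close) close _ = contradiction close ¬close

  blockAdj-out : ∀ {a b m m′} (g : Gap a b) → blockAdj g m m′ ≡ out →
                 Linked forward a b ⊎ Linked backward b a
  blockAdj-out (same _) arc = contradiction arc (sameBlock≢out _ _)
  blockAdj-out (next _) arc = inj₁ (refl , linkAdj-injective arc)
  blockAdj-out (prev _) arc = inj₂ (refl , linkAdj-injective (flipAdj-injective arc))

  blockAdj-edge : ∀ {a b m m′} (g : Gap a b) → blockAdj g m m′ ≡ edge →
                  (a ≡ b × m ≢ m′) ⊎ Linked undirected a b ⊎ Linked undirected b a
  blockAdj-edge (same _) e = inj₁ (refl , λ { refl → contradiction (trans (sym e) (sameBlock-refl _)) λ () })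
  blockAdj-edge (next _) e = inj₂ (inj₁ (refl , linkAdj-injective e))
  blockAdj-edge (prev _) e = inj₂ (inj₂ (refl , linkAdj-injective (flipAdj-injective e)))

  blockAdj-parity : ∀ {a b m m′} (g : Gap a b) → m ≡ m′ → blockAdj g m m′ ≢ none →
                    parity a ≢ parity b
  blockAdj-parity (same _) refl adjacent = contradiction (sameBlock-refl _) adjacent
  blockAdj-parity (next a) _    _        = opposite-≢ (parity a)
  blockAdj-parity (prev b) _    _        = ≢-sym (opposite-≢ (parity b))
  blockAdj-parity (far _)  _    adjacent = contradiction refl adjacent

  Vertex : Set
  Vertex = Fin (n * c)

  pos : Vertex → ℕ
  pos v = toℕ (quotient {n} c v)

  member : Vertex → Fin c
  member = remainder {n} c

  pos<n : ∀ v → pos v < n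
  pos<n v = toℕ<n (quotient {n} c v)

  blowUp : MixedGraph (n * c)
  blowUp = record
    { adj      = λ u v → blockAdj (gap (pos u) (pos v)) (member u) (member v)
    ; adj-flip = λ u v → blockAdj-flip (gap (pos u) (pos v)) (gap (pos v) (pos u))
    ; adj-loop = λ u → blockAdj-loop (gap (pos u) (pos u))
    }

  open MixedGraph blowUp

  vertex-≡ : ∀ {u v} → pos u ≡ pos v → member u ≡ member v → u ≡ v
  vertex-≡ {u} {v} pu≡pv mu≡mv = begin
    u                                      ≡⟨ combine-remQuot {n} c u ⟨
    combine (quotient {n} c u) (member u)  ≡⟨ cong₂ combine (toℕ-injective pu≡pv) mu≡mv ⟩
    combine (quotient {n} c v) (member v)  ≡⟨ combine-remQuot {n} c v ⟩
    v                                      ∎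
    where open ≡-Reasoning

  block : (a : ℕ) → a < n → Fin c → Vertex
  block a a<n m = combine (fromℕ< a<n) m

  pos-block : ∀ {a} (a<n : a < n) m → pos (block a a<n m) ≡ a
  pos-block a<n m = trans (cong (toℕ ∘ proj₁) (remQuot-combine (fromℕ< a<n) m)) (toℕ-fromℕ< a<n)

  member-block : ∀ {a} (a<n : a < n) m → member (block a a<n m) ≡ m
  member-block a<n m = cong proj₂ (remQuot-combine (fromℕ< a<n) m)

  block-injective : ∀ {a} (a<n : a < n) → Injective _≡_ _≡_ (block a a<n)
  block-injective a<n {i} {j} eq = trans (sym (member-block a<n i)) (trans (cong member eq) (member-block a<n j))

  adj-sameBlock : ∀ {u v} → pos u ≡ pos v → u ≢ v → Edge blowUp u v
  adj-sameBlock {u} {v} pu≡pv u≢v =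
    blockAdj-same (gap (pos u) (pos v)) pu≡pv (u≢v ∘ vertex-≡ pu≡pv)

  adj-consecutive : ∀ {u v a} → pos u ≡ a → pos v ≡ suc a → adj u v ≡ linkAdj (link a)
  adj-consecutive {u} {v} refl pv≡1+pu = blockAdj-next (gap (pos u) (pos v)) pv≡1+pu

  isIntervalGraph : IsIntervalGraph blowUp
  isIntervalGraph = pos , suc ∘ pos , (λ v → n≤1+n (pos v)) , λ u v u≢v →
    blockAdj⇒close (gap (pos u) (pos v)) ,
    λ close → close⇒blockAdj (gap (pos u) (pos v)) close λ (pu≡pv , mu≡mv) → u≢v (vertex-≡ pu≡pv mu≡mv)

  -- distinct vertices with the same parity of block and the same index are never adjacent
  clique≤2c : ∀ {m} {s : Fin m → Vertex} → IsClique blowUp m s → m ≤ 2 * c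
  clique≤2c {s = s} (_ , adjacent) = injective⇒≤ label-injective
    where
    label : Fin _ → Fin (2 * c)
    label i = combine (parity (pos (s i))) (member (s i))

    label-injective : Injective _≡_ _≡_ label
    label-injective {i} {j} eq with i ≟ j
    ... | yes i≡j = i≡j
    ... | no  i≢j = contradiction (combine-injectiveˡ pi mi pj mj eq)
                      (blockAdj-parity (gap (pos (s i)) (pos (s j))) (combine-injectiveʳ pi mi pj mj eq)
                                       (adjacent i j i≢j))
      where
      pi = parity (pos (s i)); pj = parity (pos (s j)); mi = member (s i); mj = member (s j)

  ArcMonotone : (ℕ → ℕ) → Set
  ArcMonotone ψ = ∀ a → suc a < n →
    (link a ≡ forward → ψ a < ψ (suc a)) × (link a ≡ backward → ψ (suc a) < ψ a)

  IsHeight : (ℕ → ℕ) → Set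
  IsHeight h = ArcMonotone h × (∀ a → suc a < n → link a ≡ undirected → h a ≢ h (suc a))

  arc-increases : ∀ {ψ} → ArcMonotone ψ → ∀ {u v} → Arc blowUp u v → ψ (pos u) < ψ (pos v)
  arc-increases {ψ} monotone {u} {v} arc =
    step (pos<n u) (pos<n v) (blockAdj-out (gap (pos u) (pos v)) arc)
    where
    step : ∀ {a b} → a < n → b < n → Linked forward a b ⊎ Linked backward b a → ψ a < ψ b
    step _   b<n (inj₁ (refl , fw)) = proj₁ (monotone _ b<n) fw
    step a<n _   (inj₂ (refl , bw)) = proj₂ (monotone _ a<n) bw

  directed-path-length≤bound : ∀ {ψ t} → ArcMonotone ψ → (∀ a → a < n → ψ a ≤ t) →
    ∀ {t′ p} → IsDirectedPath blowUp t′ p → t′ ≤ t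
  directed-path-length≤bound {ψ} monotone bounded =
    directed-path-length≤ blowUp (ψ ∘ pos) (arc-increases monotone) (λ v → bounded _ (pos<n v))

  forward-path : ∀ {t} → t < n → (∀ a → a < t → link a ≡ forward) → Fin c →
                 Σ (Fin (suc t) → Vertex) (IsDirectedPath blowUp t)
  forward-path {t} t<n forwards m = path , path-injective , path-arcs
    where
    i<n : ∀ (i : Fin (suc t)) → toℕ i < n
    i<n i = ≤-<-trans (≤-pred (toℕ<n i)) t<n

    path : Fin (suc t) → Vertex
    path i = block (toℕ i) (i<n i) m

    pos-path : ∀ i → pos (path i) ≡ toℕ i
    pos-path i = pos-block (i<n i) m

    path-injective : Injective _≡_ _≡_ path
    path-injective {i} {j} eq = toℕ-injective (trans (sym (pos-path i)) (trans (cong pos eq) (pos-path j)))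

    path-arcs : ∀ i → Arc blowUp (path (inject₁ i)) (path (fsuc i))
    path-arcs i = trans (adj-consecutive (trans (pos-path (inject₁ i)) (toℕ-inject₁ i)) (pos-path (fsuc i)))
                        (cong linkAdj (forwards (toℕ i) (toℕ<n i)))

  heightColouring : ∀ {b} (h : ℕ → ℕ) → (∀ a → a < n → h a < b) → Vertex → Fin (b * c)
  heightColouring h h<b v = combine (fromℕ< (h<b (pos v) (pos<n v))) (member v)

  heightColouring-proper : ∀ {b h} (h<b : ∀ a → a < n → h a < b) → IsHeight h →
                           IsProperColoring blowUp (b * c) (heightColouring h h<b)
  heightColouring-proper {b} {h} h<b (monotone , separates) = edge-colours , arc-colours
    where
    colour = heightColouring h h<b

    toℕ-height : ∀ v → toℕ (fromℕ< (h<b (pos v) (pos<n v))) ≡ h (pos v)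
    toℕ-height v = toℕ-fromℕ< _

    heights-differ : ∀ {a b} → a < n → b < n →
                     Linked undirected a b ⊎ Linked undirected b a → h a ≢ h b
    heights-differ _   b<n (inj₁ (refl , ud)) = separates _ b<n ud
    heights-differ a<n _   (inj₂ (refl , ud)) = ≢-sym (separates _ a<n ud)

    edge-colours : ∀ u v → Edge blowUp u v → colour u ≢ colour v
    edge-colours u v e eq with blockAdj-edge (gap (pos u) (pos v)) e
    ... | inj₁ (_ , mu≢mv) = mu≢mv (combine-injectiveʳ {m = b} _ _ _ _ eq)
    ... | inj₂ linked      = heights-differ (pos<n u) (pos<n v) linked
      (trans (sym (toℕ-height u)) (trans (cong toℕ (combine-injectiveˡ {m = b} _ _ _ _ eq)) (toℕ-height v)))

    arc-colours : ∀ u v → Arc blowUp u v → toℕ (colour u) < toℕ (colour v)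
    arc-colours u v arc = combine-monoˡ-< (member u) (member v)
      (subst₂ _<_ (sym (toℕ-height u)) (sym (toℕ-height v)) (arc-increases monotone arc))

  block-edgeClique : ∀ {a} (a<n : a < n) → IsEdgeClique blowUp (block a a<n)
  block-edgeClique a<n i j i≢j =
    adj-sameBlock (trans (pos-block a<n i) (sym (pos-block a<n j))) (i≢j ∘ block-injective a<n)

  twoBlocks-pos<n : ∀ {a} → suc a < n → (x : Fin (2 * c)) → toℕ (quotient {2} c x) + a < n
  twoBlocks-pos<n {a} 1+a<n x = ≤-<-trans (+-monoˡ-≤ a (≤-pred (toℕ<n (quotient {2} c x)))) 1+a<n

  twoBlocks : (a : ℕ) → suc a < n → Fin (2 * c) → Vertex
  twoBlocks a 1+a<n x = block (toℕ (quotient {2} c x) + a) (twoBlocks-pos<n 1+a<n x) (remainder {2} c x)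

  twoBlocks-pos : ∀ {a} (1+a<n : suc a < n) x →
                  pos (twoBlocks a 1+a<n x) ≡ a ⊎ pos (twoBlocks a 1+a<n x) ≡ suc a
  twoBlocks-pos {a} 1+a<n x =
    map-⊎ (trans pos-x) (trans pos-x) (bit (quotient {2} c x))
    where
    bit : (q : Fin 2) → toℕ q + a ≡ a ⊎ toℕ q + a ≡ suc a
    bit fzero        = inj₁ refl
    bit (fsuc fzero) = inj₂ refl

    pos-x = pos-block (twoBlocks-pos<n 1+a<n x) (remainder {2} c x)

  twoBlocks-injective : ∀ {a} (1+a<n : suc a < n) → Injective _≡_ _≡_ (twoBlocks a 1+a<n)
  twoBlocks-injective {a} 1+a<n {x} {y} eq = begin
    x                                               ≡⟨ combine-remQuot {2} c x ⟨
    combine (quotient {2} c x) (remainder {2} c x)  ≡⟨ cong₂ combine same-quotient same-remainder ⟩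
    combine (quotient {2} c y) (remainder {2} c y)  ≡⟨ combine-remQuot {2} c y ⟩
    y                                               ∎
    where
    open ≡-Reasoning
    bound = twoBlocks-pos<n 1+a<n
    same-quotient : quotient {2} c x ≡ quotient {2} c y
    same-quotient = toℕ-injective (+-cancelʳ-≡ _ _ _
      (trans (sym (pos-block (bound x) _)) (trans (cong pos eq) (pos-block (bound y) _))))
    same-remainder : remainder {2} c x ≡ remainder {2} c y
    same-remainder = trans (sym (member-block (bound x) _)) (trans (cong member eq) (member-block (bound y) _))

  twoBlocks-edgeClique : ∀ {a} (1+a<n : suc a < n) → link a ≡ undirected →
                         IsEdgeClique blowUp (twoBlocks a 1+a<n)
  twoBlocks-edgeClique {a} 1+a<n ud x y x≢y =
    joined (twoBlocks-pos 1+a<n x) (twoBlocks-pos 1+a<n y) (x≢y ∘ twoBlocks-injective 1+a<n)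
    where
    joined : ∀ {u v} → pos u ≡ a ⊎ pos u ≡ suc a → pos v ≡ a ⊎ pos v ≡ suc a → u ≢ v → Edge blowUp u v
    joined (inj₁ pu) (inj₁ pv) u≢v = adj-sameBlock (trans pu (sym pv)) u≢v
    joined (inj₂ pu) (inj₂ pv) u≢v = adj-sameBlock (trans pu (sym pv)) u≢v
    joined (inj₁ pu) (inj₂ pv) _   = trans (adj-consecutive pu pv) (cong linkAdj ud)
    joined {u} {v} (inj₂ pu) (inj₁ pv) _ =
      trans (adj-flip v u) (cong flipAdj (trans (adj-consecutive pv pu) (cong linkAdj ud)))

  module Floors {M : ℕ} {g : Vertex → Fin M} (proper : IsProperColoring blowUp M g) where

    Floor : ℕ → ℕ → Set
    Floor L a = ∀ v → pos v ≡ a → L ≤ toℕ (g v)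

    floor-beyond-arcs : ∀ {L a} (a<n : a < n) → Floor L a →
                        ∀ v → (∀ m → Arc blowUp (block a a<n m) v) → c + L ≤ toℕ (g v)
    floor-beyond-arcs a<n floor v arcs = m≤o∸n⇒m+n≤o _ L≤gv
      (edge-clique-colour-count blowUp proper (block-edgeClique a<n) above below)
      where
      above = λ m → floor _ (pos-block a<n m)
      below = λ m → proj₂ proper _ _ (arcs m)
      L≤gv = <⇒≤ (≤-<-trans (above (member v)) (below (member v)))

    floor-up : ∀ {L a} → suc a < n → link a ≡ forward → Floor L a → Floor (c + L) (suc a)
    floor-up 1+a<n fw floor v pv = floor-beyond-arcs a<n floor v
      λ m → trans (adj-consecutive (pos-block a<n m) pv) (cong linkAdj fw)
      where a<n = <-trans (n<1+n _) 1+a<n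

    floor-down : ∀ {L a} → suc a < n → link a ≡ backward → Floor L (suc a) → Floor (c + L) a
    floor-down 1+a<n bw floor v pv = floor-beyond-arcs 1+a<n floor v
      λ m → trans (adj-flip v _) (cong flipAdj (trans (adj-consecutive pv (pos-block 1+a<n m)) (cong linkAdj bw)))

    ascending-floor : ∀ {t} → t < n → (∀ a → a < t → link a ≡ forward) → Floor (t * c) t
    ascending-floor {zero}  _     _        _ _ = z≤n
    ascending-floor {suc t} 1+t<n forwards =
      floor-up 1+t<n (forwards t ≤-refl)
        (ascending-floor (<-trans (n<1+n t) 1+t<n) λ a a<t → forwards a (m<n⇒m<1+n a<t))

    descending-floor : ∀ {t a} → t + a < n → (∀ b → a ≤ b → b < t + a → link b ≡ backward) →
                       Floor (t * c) a
    descending-floor {zero}      _     _         _ _ = z≤n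
    descending-floor {suc t} {a} t+a<n backwards =
      floor-down (≤-<-trans a<1+t+a t+a<n) (backwards a ≤-refl a<1+t+a)
        (descending-floor (subst (_< n) (sym (+-suc t a)) t+a<n)
          λ b 1+a≤b b<t+1+a → backwards b (<⇒≤ 1+a≤b) (subst (b <_) (+-suc t a) b<t+1+a))
      where
      a<1+t+a : a < suc t + a
      a<1+t+a = s≤s (m≤n+m a t)

-- The links of G_k: arcs point towards the middle link k − 1, which is undirected.
inward : ℕ → ℕ → Link
inward zero          _       = backward
inward (suc k)       (suc a) = inward k a
inward (suc zero)    zero    = undirected
inward (suc (suc _)) zero    = forward

inward-forward : ∀ {k a} → suc a < k → inward k a ≡ forward
inward-forward {suc (suc _)} {zero}  _           = refl
inward-forward {suc k}       {suc a} (s≤s 1+a<k) = inward-forward 1+a<k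
inward-forward {suc zero}    {zero}  (s≤s ())

inward-middle : ∀ k → inward (suc k) k ≡ undirected
inward-middle zero    = refl
inward-middle (suc k) = inward-middle k

inward-backward : ∀ {k a} → k ≤ a → inward k a ≡ backward
inward-backward {zero}           _         = refl
inward-backward {suc k} {suc a} (s≤s k≤a) = inward-backward k≤a

inward-forward⁻¹ : ∀ k a → inward k a ≡ forward → suc a < k
inward-forward⁻¹ (suc (suc _)) zero    _  = s≤s (s≤s z≤n)
inward-forward⁻¹ (suc k)       (suc a) fw = s≤s (inward-forward⁻¹ k a fw)
inward-forward⁻¹ zero          _       ()
inward-forward⁻¹ (suc zero)    zero    ()

inward-backward⁻¹ : ∀ k a → inward k a ≡ backward → k ≤ a
inward-backward⁻¹ zero          _       _  = z≤n
inward-backward⁻¹ (suc k)       (suc a) bw = s≤s (inward-backward⁻¹ k a bw)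
inward-backward⁻¹ (suc zero)    zero    ()
inward-backward⁻¹ (suc (suc _)) zero    ()

inward-undirected⁻¹ : ∀ k a → inward k a ≡ undirected → suc a ≡ k
inward-undirected⁻¹ (suc zero)    zero    _  = refl
inward-undirected⁻¹ (suc k)       (suc a) ud = cong suc (inward-undirected⁻¹ k a ud)
inward-undirected⁻¹ zero          _       ()
inward-undirected⁻¹ (suc (suc _)) zero    ()

-- With e = 1 a potential bounding directed paths of G_k, with e = 0 the heights of its colouring.
tent : ℕ → ℕ → ℕ → ℕ
tent k e a with a <? k
... | yes _ = a
... | no  _ = 2 * k ∸ (e + a)

tent-left : ∀ {k e a} → a < k → tent k e a ≡ a
tent-left {k} {e} {a} a<k with a <? k
... | yes _   = refl
... | no  a≮k = contradiction a<k a≮k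

tent-right : ∀ {k e a} → k ≤ a → tent k e a ≡ 2 * k ∸ (e + a)
tent-right {k} {e} {a} k≤a with a <? k
... | yes a<k = contradiction k≤a (<⇒≱ a<k)
... | no  _   = refl

2*k∸[e+k]≡k∸e : ∀ k e → 2 * k ∸ (e + k) ≡ k ∸ e
2*k∸[e+k]≡k∸e k e = begin
  2 * k ∸ (e + k)  ≡⟨ cong₂ _∸_ (cong (k +_) (+-identityʳ k)) (+-comm e k) ⟩
  k + k ∸ (k + e)  ≡⟨ [m+n]∸[m+o]≡n∸o k k e ⟩
  k ∸ e            ∎
  where open ≡-Reasoning

tent-bounded : ∀ k {e} a → e ≤ 1 → tent k e a ≤ k ∸ e
tent-bounded k {e} a e≤1 with a <? k
... | yes (s≤s a≤k-1) = ≤-trans a≤k-1 (∸-monoʳ-≤ _ e≤1)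
... | no  a≮k         =
  ≤-trans (∸-monoʳ-≤ (2 * k) (+-monoʳ-≤ e (≮⇒≥ a≮k))) (≤-reflexive (2*k∸[e+k]≡k∸e k e))

tent-monotone : ∀ k {e} → e ≤ 1 → BlowUp.ArcMonotone (2 * k) k (inward k) (tent k e)
tent-monotone k {e} e≤1 a 1+a<2k = rising , falling
  where
  rising : inward k a ≡ forward → tent k e a < tent k e (suc a)
  rising fw = subst₂ _<_ (sym (tent-left (<-trans (n<1+n a) 1+a<k))) (sym (tent-left 1+a<k)) (n<1+n a)
    where 1+a<k = inward-forward⁻¹ k a fw

  falling : inward k a ≡ backward → tent k e (suc a) < tent k e a
  falling bw = subst₂ _<_ (sym (tent-right (m≤n⇒m≤1+n k≤a))) (sym (tent-right k≤a))
    (∸-monoʳ-< (+-monoʳ-< e (n<1+n a)) (≤-trans (+-monoˡ-≤ (suc a) e≤1) 1+a<2k))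
    where k≤a = inward-backward⁻¹ k a bw

tent-height : ∀ k → BlowUp.IsHeight (2 * k) k (inward k) (tent k 0)
tent-height k = tent-monotone k z≤n , separates
  where
  separates : ∀ a → suc a < 2 * k → inward k a ≡ undirected → tent k 0 a ≢ tent k 0 (suc a)
  separates a _ ud with inward-undirected⁻¹ k a ud
  ... | refl = subst₂ _≢_ (sym (tent-left {suc a} {0} (n<1+n a)))
                          (sym (trans (tent-right {suc a} {0} ≤-refl) (2*k∸[e+k]≡k∸e (suc a) 0)))
                          (≢-sym 1+n≢n)

inwardGraph : (k : ℕ) → MixedGraph (2 * k * k)
inwardGraph k = BlowUp.blowUp (2 * k) k (inward k)

Invariants : ℕ → ∀ {N} → MixedGraph N → Set
Invariants k G = IsIntervalGraph G × LongestDirectedPath G (k ∸ 1) × CliqueNumber G (2 * k)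
               × ChromaticNumber G ((k + 1) * k)

module _ (k′ : ℕ) where
  private
    k = suc k′
  open BlowUp (2 * k) k (inward k)

  k<2k : k < 2 * k
  k<2k = m<m+n k z<s

  k′+k<2k : k′ + k < 2 * k
  k′+k<2k = s≤s (≤-reflexive (cong (k′ +_) (sym (+-identityʳ k))))

  height<1+k : ∀ a → a < 2 * k → tent k 0 a < k + 1
  height<1+k a _ = ≤-<-trans (tent-bounded k a z≤n) (m<m+n k z<s)

  left-forward : ∀ a → a < k′ → inward k a ≡ forward
  left-forward a a<k′ = inward-forward (s≤s a<k′)

  chromatic≥ : ∀ M (g : Vertex → Fin M) → IsProperColoring blowUp M g → (k + 1) * k ≤ M
  chromatic≥ M g proper = subst (_≤ M) (sym count)
    (m≤o∸n⇒m+n≤o (2 * k) (<⇒≤ (≤-<-trans (floor fzero) (toℕ<n _)))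
      (edge-clique-colour-count blowUp proper (twoBlocks-edgeClique k<2k (inward-middle k′))
                                floor (λ _ → toℕ<n _)))
    where
    open Floors proper
    floor : ∀ x → k′ * k ≤ toℕ (g (twoBlocks k′ k<2k x))
    floor x = [ ascending-floor (<-trans (n<1+n k′) k<2k) left-forward _
              , descending-floor k′+k<2k (λ b k≤b _ → inward-backward k≤b) _ ]′
              (twoBlocks-pos k<2k x)
    count : (k + 1) * k ≡ 2 * k + k′ * k
    count = trans (cong (_* k) (+-comm k 1)) (*-distribʳ-+ k 2 k′)

  inwardGraph-invariants : Invariants k (inwardGraph k)
  inwardGraph-invariants =
    isIntervalGraph ,
    (forward-path (<-trans (n<1+n k′) k<2k) left-forward fzero ,
      λ _ _ → directed-path-length≤bound (tent-monotone k ≤-refl) (λ a _ → tent-bounded k a ≤-refl)) ,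
    ((twoBlocks k′ k<2k , edge-clique⇒clique blowUp (twoBlocks-edgeClique k<2k (inward-middle k′))) ,
      λ _ _ → clique≤2c) ,
    (heightColouring (tent k 0) height<1+k , heightColouring-proper height<1+k (tent-height k)) ,
    chromatic≥

subst-preserves : (P : ∀ {N} → MixedGraph N → Set) {M N : ℕ} (M≡N : M ≡ N) {G : MixedGraph M} →
                  P G → P (subst MixedGraph M≡N G)
subst-preserves _ refl p = p

proposition8 : Σ ((k : ℕ) → MixedGraph (2 * (k * k))) λ G →
      ∀ (k : ℕ) → 1 ≤ k →
        IsIntervalGraph (G k)
        × LongestDirectedPath (G k) (k ∸ 1)
        × CliqueNumber (G k) (2 * k)
        × ChromaticNumber (G k) ((k + 1) * k)
proposition8 = (λ k → subst MixedGraph (*-assoc 2 k k) (inwardGraph k)) , invariants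
  where
  invariants : ∀ k → 1 ≤ k → Invariants k (subst MixedGraph (*-assoc 2 k k) (inwardGraph k))
  invariants (suc k′) _ = subst-preserves (Invariants (suc k′)) (*-assoc 2 (suc k′) (suc k′))
                                          (inwardGraph-invariants k′)
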